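{- If $(P,Q)$ is a border of an $n$-cbc $X$, then for all $i,j\in\mathbb Z$, every integer $d_1$ coprime to $|P|$ and every integer $d_2$ coprime to $|Q|$, the ordered pairs $(P+i,\,Q+j)$ and $(d_1P,\,d_2Q)$ are borders of $X$.
   Context: Fix an alphabet $\mathcal A$ containing distinct letters $a,b$. A code is a set $X\subseteq\mathcal A^*$ such that $x_1\cdots x_t=y_1\cdots y_{t'}$ with $x_i,y_i\in X$ implies $t=t'$ and $x_i=y_i$ for all $i$. Write $[n]=\{0,\dots,n-1\}$, $a^U=\{a^u:u\in U\}$, $U+i=\{u+i:u\in U\}$, $dU=\{du:u\in U\}$. An $n$-cbc is a set $X\subseteq a^{[n]}ba^{[n]}$ with $|X|=n$ such that $\{a^n\}\cup X$ is a code. For $X\subseteq\mathcal A^*$, $\underline X=\sum_{x\in X}x$ in $\mathbb Z\langle\langle\mathcal A\rangle\rangle$; $\equiv_n$ is the congruence generated by $a^n=\varepsilon$ (exponents of $a$ read modulo $n$). For finite $P,Q\subseteq\mathbb Z$, $(P,Q)$ is a border of an $n$-cbc $X$ if $\underline{a^P}\,\underline X\,\underline{a^Q}\equiv_n\sum_{i,j\in[n]}a^iba^j$ (products with multiplicity). -}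

module Defs where

open import Data.Bool using (Bool; if_then_else_)
open import Data.Nat as ℕ using (ℕ)
open import Data.Nat.Divisibility using (_∣_; _∣?_)
open import Data.Integer as ℤ using (ℤ; +_; ∣_∣)
open import Data.Fin using (Fin; toℕ)
open import Data.Product using (_×_; _,_)
open import Data.Sum using (_⊎_)
open import Data.List using (List; []; _∷_; _++_; replicate; concat; map; length)
open import Data.Nat.ListAction using (sum)
open import Data.List.Relation.Unary.All using (All)
open import Data.List.Relation.Unary.Any using (Any)
open import Data.List.Relation.Unary.Unique.Propositional using (Unique)
open import Relation.Nullary.Decidable using (Dec; ⌊_⌋; _×-dec_)
open import Relation.Binary.PropositionalEquality using (_≡_)

IsCode : {A : Set} → (List A → Set) → Set
IsCode {A} S = (xs ys : List (List A)) → All S xs → All S ys →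
               concat xs ≡ concat ys → xs ≡ ys

word : {A : Set} → A → A → ℕ × ℕ → List A
word a b (i , j) = replicate i a ++ (b ∷ replicate j a)

wordF : {A : Set} → A → A → (n : ℕ) → Fin n × Fin n → List A
wordF a b n (i , j) = word a b (toℕ i , toℕ j)

InAnX : {A : Set} → A → A → (n : ℕ) → List (Fin n × Fin n) → List A → Set
InAnX a b n X w = (w ≡ replicate n a) ⊎ Any (λ p → w ≡ wordF a b n p) X

IsCbc : {A : Set} → A → A → (n : ℕ) → List (Fin n × Fin n) → Set
IsCbc a b n X = Unique X × length X ≡ n × IsCode (InAnX a b n X)

_≡[_]_ : ℤ → ℕ → ℤ → Set
x ≡[ n ] y = n ∣ ∣ x ℤ.- y ∣

_≡[_]?_ : (x : ℤ) (n : ℕ) (y : ℤ) → Dec (x ≡[ n ] y)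
x ≡[ n ]? y = n ∣? ∣ x ℤ.- y ∣

-- coefficient of a^i b a^j (i , j ∈ [n]) in  a^P · X · a^Q  modulo a^n = ε,
-- counted with multiplicity over P × X × Q
coeff : (n : ℕ) → List ℤ → List (Fin n × Fin n) → List ℤ → Fin n → Fin n → ℕ
coeff n P X Q i j =
  sum (map (λ p → sum (map (λ x → sum (map (λ q → ind p x q) Q)) X)) P)
  where
  ind : ℤ → Fin n × Fin n → ℤ → ℕ
  ind p (u , v) q =
    if ⌊ ((p ℤ.+ + toℕ u) ≡[ n ]? (+ toℕ i)) ×-dec ((+ toℕ v ℤ.+ q) ≡[ n ]? (+ toℕ j)) ⌋
    then 1 else 0

-- (P , Q) is a border of X:  a^P X a^Q ≡_n Σ_{i,j ∈ [n]} a^i b a^j,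
-- i.e. every normal form a^i b a^j (i , j ∈ [n]) has coefficient exactly 1
-- (P , Q are finite sets of integers represented by duplicate-free lists)
IsBorder : (n : ℕ) → List (Fin n × Fin n) → List ℤ → List ℤ → Set
IsBorder n X P Q = (i j : Fin n) → coeff n P X Q i j ≡ 1

-- Reading exponents of a modulo n, the coefficient of a^i b a^j in a^P X a^Q is, for fixed j,
-- the value at i of P ▷ K, where (P ▷ K) y = Σ_{t ∈ P} K (y − t) and K is the n-periodic
-- function giving the coefficients of X a^Q in column j; symmetrically for fixed i with Q.
-- So (P, Q) is a border iff the translates by P, resp. Q, of these periodic functions tile ℤ.
-- Translating P or Q merely shifts i or j. For a prime p not dividing |P|, the Frobenius
-- congruence (P ▷)^p K ≡ pP ▷ K (mod p), together with (P ▷)^p K = |P|^(p−1), shows that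
-- pP ▷ K vanishes nowhere; its sum over a period is |P| times that of K, as is the sum of
-- P ▷ K = 1, namely n, so pP ▷ K is identically 1. Finally every d coprime to |P| is
-- congruent modulo n to a positive integer coprime to |P|, that is, to a product of such primes.

module Submission where

open import Defs
open import Data.Nat using (ℕ)
open import Data.Nat.Coprimality using (Coprime)
open import Data.Fin using (Fin)
open import Data.Product using (_×_)
open import Data.List using (List; map; length; deduplicate)
open import Data.List.Relation.Unary.Unique.Propositional using (Unique)
open import Relation.Binary.PropositionalEquality using (_≢_)

module Tiling where

  open import Algebra.Properties.CommutativeSemigroup using (interchange; x∙yz≈y∙xz)
  open import Data.Fin using (zero; suc; toℕ; inject₁; fromℕ; fromℕ<)
  open import Data.Fin.Properties using (toℕ<n; toℕ-inject₁; toℕ-fromℕ; toℕ-fromℕ<)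
  open import Data.Integer as ℤ using (ℤ)
  import Data.Integer.DivMod as ℤ
  import Data.Integer.Divisibility.Signed as ℤ∣
  import Data.Integer.Properties as ℤ
  import Data.Integer.Tactic.RingSolver as ℤ-Solver
  open import Data.List using ([]; _∷_)
  open import Data.List.Properties using (map-cong; map-∘; map-id; length-map; filter-all)
  open import Data.List.Relation.Unary.All using (All; []; _∷_)
  open import Data.List.Relation.Unary.AllPairs using ([]; _∷_)
  import Data.List.Relation.Unary.Unique.Propositional.Properties as Unique
  open import Data.Nat
    using ( zero; suc; _+_; _*_; _∸_; _^_; _<_; _≤_; z≤n; z<s; s<s
          ; NonZero; ≢-nonZero⁻¹; >-nonZero; >-nonZero⁻¹; nonTrivial⇒≢1)
  open import Data.Nat.Combinatorics using (_C_; nCk+nC[k+1]≡[n+1]C[k+1]; k>n⇒nCk≡0; nCn≡1; nC1≡n)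
  open import Data.Nat.Divisibility
    using (_∣_; module _∣_; divides; _∣0; ∣m∣n⇒∣m+n; ∣m+n∣m⇒∣n; ∣m⇒∣m*n; ∣n⇒∣m*n; ∣⇒≤; ∣1⇒≡1; ∣-refl)
  open import Data.Nat.GeneralisedArithmetic using (fold)
  open import Data.Nat.ListAction using (sum; product)
  open import Data.Nat.Primality using (Prime; euclidsLemma; prime⇒nonZero; prime⇒nonTrivial)
  open import Data.Nat.Primality.Factorisation using (factorise; module PrimeFactorisation)
  open import Data.Nat.Properties
  import Data.Nat.Tactic.RingSolver as ℕ-Solver
  open import Data.Product using (_,_; ∃-syntax; proj₁; proj₂)
  open import Data.Sum using (inj₁; inj₂)
  open import Function using (_∘_)
  open import Relation.Binary.Definitions using (DecidableEquality)
  open import Relation.Binary.PropositionalEquality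
  open import Relation.Nullary using (¬_; ¬?; contradiction)
  import Algebra.Properties.CommutativeMonoid.Sum +-0-commutativeMonoid as ∑
  open ∑ using (sum-syntax; sum-cong-≗; ∑-distrib-+; sum-init-last)

  -- Finite sums

  sum-map-+ : ∀ {B : Set} (L : List B) (f g : B → ℕ) →
    sum (map (λ x → f x + g x) L) ≡ sum (map f L) + sum (map g L)
  sum-map-+ []      f g = refl
  sum-map-+ (x ∷ L) f g =
    trans (cong ((f x + g x) +_) (sum-map-+ L f g)) (interchange +-commutativeSemigroup (f x) (g x) _ _)

  sum-map-const : ∀ {B : Set} (L : List B) (c : ℕ) → sum (map (λ _ → c) L) ≡ length L * c
  sum-map-const []      c = refl
  sum-map-const (x ∷ L) c = cong (c +_) (sum-map-const L c)

  sum-map-swap : ∀ {B C : Set} (L : List B) (M : List C) (f : B → C → ℕ) →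
    sum (map (λ x → sum (map (f x) M)) L) ≡ sum (map (λ y → sum (map (λ x → f x y) L)) M)
  sum-map-swap []      M f = sym (trans (sum-map-const M 0) (*-zeroʳ (length M)))
  sum-map-swap (x ∷ L) M f =
    trans (cong (sum (map (f x) M) +_) (sum-map-swap L M f)) (sym (sum-map-+ M (f x) _))

  ∑-drop-last : ∀ {k} (f : Fin (suc k) → ℕ) → f (fromℕ k) ≡ 0 →
    ∑[ j < suc k ] f j ≡ ∑[ j < k ] f (inject₁ j)
  ∑-drop-last {k} f last≡0 = begin
    ∑[ j < suc k ] f j                     ≡⟨ sum-init-last f ⟩
    ∑[ j < k ] f (inject₁ j) + f (fromℕ k) ≡⟨ cong (∑[ j < k ] f (inject₁ j) +_) last≡0 ⟩
    ∑[ j < k ] f (inject₁ j) + 0           ≡⟨ +-identityʳ _ ⟩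
    ∑[ j < k ] f (inject₁ j)               ∎
    where open ≡-Reasoning

  ∑-∣ : ∀ {d k} (f : Fin k → ℕ) → (∀ j → d ∣ f j) → d ∣ ∑[ j < k ] f j
  ∑-∣ {k = zero}  f d∣f = _ ∣0
  ∑-∣ {k = suc k} f d∣f = ∣m∣n⇒∣m+n (d∣f zero) (∑-∣ (f ∘ suc) (d∣f ∘ suc))

  ∑-1 : ∀ k → ∑[ i < k ] 1 ≡ k
  ∑-1 zero    = refl
  ∑-1 (suc k) = cong suc (∑-1 k)

  ∑≥size : ∀ {k} (f : Fin k → ℕ) → (∀ i → 1 ≤ f i) → k ≤ ∑[ i < k ] f i
  ∑≥size {zero}  f f≥1 = z≤n
  ∑≥size {suc k} f f≥1 = +-mono-≤ (f≥1 zero) (∑≥size (f ∘ suc) (f≥1 ∘ suc))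

  ∑≡size⇒≡1 : ∀ {k} (f : Fin k → ℕ) → (∀ i → 1 ≤ f i) → ∑[ i < k ] f i ≡ k → ∀ i → f i ≡ 1
  ∑≡size⇒≡1 {zero}  f f≥1 ∑≡k ()
  ∑≡size⇒≡1 {suc k} f f≥1 ∑≡k = λ where
      zero    → head≡1
      (suc i) → ∑≡size⇒≡1 (f ∘ suc) (f≥1 ∘ suc) tail≡k i
    where
    head≡1 : f zero ≡ 1
    head≡1 = ≤-antisym
      (+-cancelʳ-≤ k (f zero) 1
        (≤-trans (+-monoʳ-≤ (f zero) (∑≥size (f ∘ suc) (f≥1 ∘ suc))) (≤-reflexive ∑≡k)))
      (f≥1 zero)
    tail≡k : ∑[ j < k ] f (suc j) ≡ k
    tail≡k = suc-injective (trans (cong (_+ ∑[ j < k ] f (suc j)) (sym head≡1)) ∑≡k)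

  -- Binomial coefficients and primes

  C-absorption : ∀ n k → suc k * (suc n C suc k) ≡ suc n * (n C k)
  C-absorption zero    zero    = refl
  C-absorption zero    (suc k) = *-zeroʳ (suc (suc k))
  C-absorption (suc n) zero    = trans (*-identityˡ _) (trans (nC1≡n (2 + n)) (sym (*-identityʳ (2 + n))))
  C-absorption (suc n) (suc k) = begin
    (2 + k) * ((2 + n) C (2 + k))
      ≡⟨ cong ((2 + k) *_) (nCk+nC[k+1]≡[n+1]C[k+1] (suc n) (suc k)) ⟨
    (2 + k) * (w + z)
      ≡⟨ distribute k w z ⟩
    w + (1 + k) * w + (2 + k) * z
      ≡⟨ cong₂ (λ u v → w + u + v) (C-absorption n k) (C-absorption n (suc k)) ⟩
    w + (1 + n) * x + (1 + n) * y
      ≡⟨ cong (λ u → u + (1 + n) * x + (1 + n) * y) (nCk+nC[k+1]≡[n+1]C[k+1] n k) ⟨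
    (x + y) + (1 + n) * x + (1 + n) * y
      ≡⟨ collect n x y ⟩
    (2 + n) * (x + y)
      ≡⟨ cong ((2 + n) *_) (nCk+nC[k+1]≡[n+1]C[k+1] n k) ⟩
    (2 + n) * w                          ∎
    where
    open ≡-Reasoning
    x = n C k
    y = n C suc k
    w = suc n C suc k
    z = suc n C (2 + k)
    distribute : ∀ k w z → (2 + k) * (w + z) ≡ w + (1 + k) * w + (2 + k) * z
    distribute = ℕ-Solver.solve-∀
    collect : ∀ n x y → (x + y) + (1 + n) * x + (1 + n) * y ≡ (2 + n) * (x + y)
    collect = ℕ-Solver.solve-∀

  prime∣pCk : ∀ {p k} → Prime p → 0 < k → k < p → p ∣ p C k
  prime∣pCk {suc n} {suc k} pr _ k<p with euclidsLemma (suc k) (suc n C suc k) pr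
    (divides (n C k) (trans (C-absorption n k) (*-comm (suc n) (n C k))))
  ... | inj₁ p∣k = contradiction (∣⇒≤ p∣k) (<⇒≱ k<p)
  ... | inj₂ p∣C = p∣C

  prime∣^⇒∣ : ∀ {p m} → Prime p → ∀ k → p ∣ m ^ k → p ∣ m
  prime∣^⇒∣ pr zero    p∣1 = contradiction (∣1⇒≡1 p∣1) (nonTrivial⇒≢1 {{prime⇒nonTrivial pr}})
  prime∣^⇒∣ {m = m} pr (suc k) p∣m^k+1 with euclidsLemma m (m ^ k) pr p∣m^k+1
  ... | inj₁ p∣m   = p∣m
  ... | inj₂ p∣m^k = prime∣^⇒∣ pr k p∣m^k

  -- Translates of a function by a list of integers

  infixr 5 _▷_

  _▷_ : List ℤ → (ℤ → ℕ) → ℤ → ℕ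
  (P ▷ K) y = sum (map (λ t → K (y ℤ.- t)) P)

  ▷-cong : ∀ P {K K′ : ℤ → ℕ} → K ≗ K′ → P ▷ K ≗ P ▷ K′
  ▷-cong P K≗K′ y = cong sum (map-cong (λ t → K≗K′ (y ℤ.- t)) P)

  ▷-const : ∀ P {K : ℤ → ℕ} {c} → (∀ y → K y ≡ c) → ∀ y → (P ▷ K) y ≡ length P * c
  ▷-const P {c = c} K≡c y = trans (cong sum (map-cong (λ t → K≡c (y ℤ.- t)) P)) (sum-map-const P c)

  ▷-shift : ∀ P (K : ℤ → ℕ) c y → (P ▷ (λ z → K (z ℤ.- c))) y ≡ (P ▷ K) (y ℤ.- c)
  ▷-shift P K c y = cong sum (map-cong (λ t → cong K (swap y t c)) P)
    where
    swap : ∀ y t c → y ℤ.- t ℤ.- c ≡ y ℤ.- c ℤ.- t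
    swap = ℤ-Solver.solve-∀

  ▷-linear : ∀ P {N} (c : Fin N → ℕ) (F : Fin N → ℤ → ℕ) y →
    (P ▷ (λ z → ∑[ j < N ] (c j * F j z))) y ≡ ∑[ j < N ] (c j * (P ▷ F j) y)
  ▷-linear []      {N} c F y = sym (trans (sum-cong-≗ (λ j → *-zeroʳ (c j))) (∑.sum-replicate-zero N))
  ▷-linear (t ∷ P) {N} c F y = begin
    ∑[ j < N ] (c j * F j (y ℤ.- t)) + (P ▷ (λ z → ∑[ j < N ] (c j * F j z))) y
      ≡⟨ cong (∑[ j < N ] (c j * F j (y ℤ.- t)) +_) (▷-linear P c F y) ⟩
    ∑[ j < N ] (c j * F j (y ℤ.- t)) + ∑[ j < N ] (c j * (P ▷ F j) y)
      ≡⟨ sym (∑-distrib-+ (λ j → c j * F j (y ℤ.- t)) (λ j → c j * (P ▷ F j) y)) ⟩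
    ∑[ j < N ] (c j * F j (y ℤ.- t) + c j * (P ▷ F j) y)
      ≡⟨ sum-cong-≗ (λ j → sym (*-distribˡ-+ (c j) _ _)) ⟩
    ∑[ j < N ] (c j * ((t ∷ P) ▷ F j) y) ∎
    where open ≡-Reasoning

  fold-▷-const : ∀ P {K : ℤ → ℕ} → (∀ y → (P ▷ K) y ≡ 1) →
    ∀ k y → fold K (P ▷_) (suc k) y ≡ length P ^ k
  fold-▷-const P P▷K≡1 zero    y = P▷K≡1 y
  fold-▷-const P P▷K≡1 (suc k) y = ▷-const P (fold-▷-const P P▷K≡1 k) y

  ▷-map-+ : ∀ P (F : ℤ → ℕ) s y → (map (ℤ._+ s) P ▷ F) y ≡ (P ▷ F) (y ℤ.- s)
  ▷-map-+ P F s y = cong sum (trans (sym (map-∘ P)) (map-cong (λ t → cong F (regroup y t s)) P))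
    where
    regroup : ∀ y t s → y ℤ.- (t ℤ.+ s) ≡ y ℤ.- s ℤ.- t
    regroup = ℤ-Solver.solve-∀

  -- The Frobenius congruence

  module Binomial (a : ℤ) (A : List ℤ) (K : ℤ → ℕ) where

    term : ℕ → ℕ → ℤ → ℕ
    term j m y = fold K (A ▷_) m (y ℤ.- ℤ.+ j ℤ.* a)

    term-zero : ∀ m y → term 0 m y ≡ fold K (A ▷_) m y
    term-zero m y = cong (fold K (A ▷_) m) (y-0*a≡y y a)
      where
      y-0*a≡y : ∀ y a → y ℤ.- ℤ.+ 0 ℤ.* a ≡ y
      y-0*a≡y = ℤ-Solver.solve-∀

    term-shift : ∀ j m y → term j m (y ℤ.- a) ≡ term (suc j) m y
    term-shift j m y =
      cong (fold K (A ▷_) m) (trans (regroup y a (ℤ.+ j)) (cong (λ i → y ℤ.- i ℤ.* a) (sym (ℤ.pos-+ 1 j))))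
      where
      regroup : ∀ y a i → y ℤ.- a ℤ.- i ℤ.* a ≡ y ℤ.- (ℤ.+ 1 ℤ.+ i) ℤ.* a
      regroup = ℤ-Solver.solve-∀

    term-▷ : ∀ j m y → (A ▷ term j m) y ≡ term j (suc m) y
    term-▷ j m y = ▷-shift A (fold K (A ▷_) m) (ℤ.+ j ℤ.* a) y

    expansion : ℕ → ℤ → ℕ
    expansion k y = ∑[ j < suc k ] ((k C toℕ j) * term (toℕ j) (k ∸ toℕ j) y)

    expansion-shift : ∀ k y →
      expansion k (y ℤ.- a) ≡ ∑[ j < suc k ] ((k C toℕ j) * term (suc (toℕ j)) (k ∸ toℕ j) y)
    expansion-shift k y = sum-cong-≗ {suc k} (λ j → cong ((k C toℕ j) *_) (term-shift (toℕ j) (k ∸ toℕ j) y))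

    expansion-▷ : ∀ k y → (A ▷ expansion k) y ≡
      1 * term 0 (suc k) y + ∑[ j < suc k ] ((k C suc (toℕ j)) * term (suc (toℕ j)) (k ∸ toℕ j) y)
    expansion-▷ k y = begin
      (A ▷ expansion k) y
        ≡⟨ ▷-linear A {suc k} (λ j → k C toℕ j) (λ j → term (toℕ j) (k ∸ toℕ j)) y ⟩
      ∑[ j < suc k ] ((k C toℕ j) * (A ▷ term (toℕ j) (k ∸ toℕ j)) y)
        ≡⟨ sum-cong-≗ {suc k} (λ j → cong ((k C toℕ j) *_) (term-▷ (toℕ j) (k ∸ toℕ j) y)) ⟩
      1 * term 0 (suc k) y + ∑[ j < k ] ((k C suc (toℕ j)) * term (suc (toℕ j)) (suc (k ∸ suc (toℕ j))) y)
        ≡⟨ cong (1 * term 0 (suc k) y +_) (sum-cong-≗ {k} g∘inject₁) ⟨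
      1 * term 0 (suc k) y + ∑[ j < k ] g (inject₁ j)
        ≡⟨ cong (1 * term 0 (suc k) y +_) (∑-drop-last g g-last≡0) ⟨
      1 * term 0 (suc k) y + ∑[ j < suc k ] g j ∎
      where
      open ≡-Reasoning
      g : Fin (suc k) → ℕ
      g j = (k C suc (toℕ j)) * term (suc (toℕ j)) (k ∸ toℕ j) y
      g∘inject₁ : ∀ j → g (inject₁ j) ≡ (k C suc (toℕ j)) * term (suc (toℕ j)) (suc (k ∸ suc (toℕ j))) y
      g∘inject₁ j = trans (cong (λ i → (k C suc i) * term (suc i) (k ∸ i) y) (toℕ-inject₁ j))
                          (cong (λ m → (k C suc (toℕ j)) * term (suc (toℕ j)) m y) (+-∸-assoc 1 (toℕ<n j)))
      g-last≡0 : g (fromℕ k) ≡ 0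
      g-last≡0 = cong (_* term (suc (toℕ (fromℕ k))) (k ∸ toℕ (fromℕ k)) y)
                      (k>n⇒nCk≡0 (subst (k <_) (cong suc (sym (toℕ-fromℕ k))) (n<1+n k)))

    fold-▷-binomial : ∀ k y → fold K ((a ∷ A) ▷_) k y ≡ expansion k y
    fold-▷-binomial zero    y = sym (trans (+-identityʳ (1 * term 0 0 y)) (trans (*-identityˡ _) (term-zero 0 y)))
    fold-▷-binomial (suc k) y = begin
      fold K ((a ∷ A) ▷_) k (y ℤ.- a) + (A ▷ fold K ((a ∷ A) ▷_) k) y
        ≡⟨ cong₂ _+_ (fold-▷-binomial k (y ℤ.- a)) (▷-cong A (fold-▷-binomial k) y) ⟩
      expansion k (y ℤ.- a) + (A ▷ expansion k) y
        ≡⟨ cong₂ _+_ (expansion-shift k y) (expansion-▷ k y) ⟩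
      ∑[ j < suc k ] f j + (W₀ + ∑[ j < suc k ] g j)
        ≡⟨ x∙yz≈y∙xz +-commutativeSemigroup (∑[ j < suc k ] f j) W₀ _ ⟩
      W₀ + (∑[ j < suc k ] f j + ∑[ j < suc k ] g j)
        ≡⟨ cong (W₀ +_) (sym (∑-distrib-+ f g)) ⟩
      W₀ + ∑[ j < suc k ] (f j + g j)
        ≡⟨ cong (W₀ +_) (sum-cong-≗ {suc k} pascal) ⟩
      expansion (suc k) y ∎
      where
      open ≡-Reasoning
      W₀ = 1 * term 0 (suc k) y
      f g : Fin (suc k) → ℕ
      f j = (k C toℕ j) * term (suc (toℕ j)) (k ∸ toℕ j) y
      g j = (k C suc (toℕ j)) * term (suc (toℕ j)) (k ∸ toℕ j) y
      pascal : ∀ j → f j + g j ≡ (suc k C suc (toℕ j)) * term (suc (toℕ j)) (k ∸ toℕ j) y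
      pascal j = trans (sym (*-distribʳ-+ (term (suc (toℕ j)) (k ∸ toℕ j) y) (k C toℕ j) (k C suc (toℕ j))))
                       (cong (_* term (suc (toℕ j)) (k ∸ toℕ j) y) (nCk+nC[k+1]≡[n+1]C[k+1] k (toℕ j)))

  frobenius : ∀ {p} → Prime p → ∀ A K y →
    ∃[ r ] fold K (A ▷_) p y ≡ (map (ℤ.+ p ℤ.*_) A ▷ K) y + r * p
  frobenius {zero}  pr = contradiction refl (≢-nonZero⁻¹ 0 {{prime⇒nonZero pr}})
  frobenius {suc q} pr []      K y = 0 , refl
  frobenius {suc q} pr (a ∷ A) K y = r + m , (begin
    fold K ((a ∷ A) ▷_) p y
      ≡⟨ fold-▷-binomial p y ⟩
    1 * term 0 p y + ∑[ j < p ] h (suc j)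
      ≡⟨ cong₂ _+_ (trans (*-identityˡ _) (term-zero p y)) (sum-init-last (h ∘ suc)) ⟩
    fold K (A ▷_) p y + (∑[ j < q ] h (suc (inject₁ j)) + h (suc (fromℕ q)))
      ≡⟨ cong₂ (λ u v → u + (v + h (suc (fromℕ q)))) eqA eqm ⟩
    (D + r * p) + (m * p + h (suc (fromℕ q)))
      ≡⟨ cong (λ v → (D + r * p) + (m * p + v)) last-term ⟩
    (D + r * p) + (m * p + K (y ℤ.- ℤ.+ p ℤ.* a))
      ≡⟨ regroup D r m p _ ⟩
    (K (y ℤ.- ℤ.+ p ℤ.* a) + D) + (r + m) * p ∎)
    where
    open ≡-Reasoning
    open Binomial a A K
    p = suc q
    D = (map (ℤ.+ p ℤ.*_) A ▷ K) y
    r = proj₁ (frobenius pr A K y)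
    eqA = proj₂ (frobenius pr A K y)
    h : Fin (suc p) → ℕ
    h j = (p C toℕ j) * term (toℕ j) (p ∸ toℕ j) y
    p∣middle : p ∣ ∑[ j < q ] h (suc (inject₁ j))
    p∣middle = ∑-∣ (h ∘ suc ∘ inject₁) (λ j →
      ∣m⇒∣m*n _ (prime∣pCk pr z<s (s<s (subst (_< q) (sym (toℕ-inject₁ j)) (toℕ<n j)))))
    m = _∣_.quotient p∣middle
    eqm = _∣_.equality p∣middle
    last-term : h (suc (fromℕ q)) ≡ K (y ℤ.- ℤ.+ p ℤ.* a)
    last-term = begin
      (p C suc (toℕ (fromℕ q))) * term (suc (toℕ (fromℕ q))) (q ∸ toℕ (fromℕ q)) y
        ≡⟨ cong (λ i → (p C suc i) * term (suc i) (q ∸ i) y) (toℕ-fromℕ q) ⟩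
      (p C p) * term p (q ∸ q) y   ≡⟨ cong₂ (λ c m → c * term p m y) (nCn≡1 p) (n∸n≡0 q) ⟩
      1 * term p 0 y               ≡⟨ *-identityˡ _ ⟩
      K (y ℤ.- ℤ.+ p ℤ.* a)        ∎
    regroup : ∀ D r m p v → (D + r * p) + (m * p + v) ≡ (v + D) + (r + m) * p
    regroup = ℕ-Solver.solve-∀

  -- Periodic functions

  ≡[]-by-difference : ∀ {n} x y x′ y′ → x ℤ.- y ≡ x′ ℤ.- y′ → x′ ≡[ n ] y′ → x ≡[ n ] y
  ≡[]-by-difference {n} _ _ _ _ eq = subst (λ d → n ∣ ℤ.∣ d ∣) (sym eq)

  ≡[]-multiple : ∀ {n} x y q → x ℤ.- y ≡ q ℤ.* ℤ.+ n → x ≡[ n ] y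
  ≡[]-multiple _ _ q eq = ℤ∣.∣⇒∣ᵤ (ℤ∣.divides q eq)

  ≡[]-sym : ∀ {n} x y → x ≡[ n ] y → y ≡[ n ] x
  ≡[]-sym {n} x y = subst (n ∣_) (ℤ.∣i-j∣≡∣j-i∣ x y)

  ≡[]-trans : ∀ {n} x y z → x ≡[ n ] y → y ≡[ n ] z → x ≡[ n ] z
  ≡[]-trans {n} x y z x≡y y≡z =
    ℤ∣.∣⇒∣ᵤ (subst (ℤ.+ n ℤ∣.∣_) (telescope x y z)
      (ℤ∣.∣m∣n⇒∣m+n (ℤ∣.∣ᵤ⇒∣ {i = x ℤ.- y} x≡y) (ℤ∣.∣ᵤ⇒∣ {i = y ℤ.- z} y≡z)))
    where
    telescope : ∀ x y z → (x ℤ.- y) ℤ.+ (y ℤ.- z) ≡ x ℤ.- z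
    telescope = ℤ-Solver.solve-∀

  ≡[]-*ʳ : ∀ {n} x y t → x ≡[ n ] y → (x ℤ.* t) ≡[ n ] (y ℤ.* t)
  ≡[]-*ʳ {n} x y t x≡y =
    ℤ∣.∣⇒∣ᵤ (subst (ℤ.+ n ℤ∣.∣_) (distrib x y t)
      (ℤ∣.∣m⇒∣m*n t (ℤ∣.∣ᵤ⇒∣ {i = x ℤ.- y} x≡y)))
    where
    distrib : ∀ x y t → (x ℤ.- y) ℤ.* t ≡ x ℤ.* t ℤ.- y ℤ.* t
    distrib = ℤ-Solver.solve-∀

  Periodic : ℕ → (ℤ → ℕ) → Set
  Periodic n K = ∀ x y → x ≡[ n ] y → K x ≡ K y

  periodic-shift : ∀ {n K} c → Periodic n K → Periodic n (λ x → K (x ℤ.- c))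
  periodic-shift c K-per x y x≡y = K-per _ _ (≡[]-by-difference (x ℤ.- c) (y ℤ.- c) x y (cancel x y c) x≡y)
    where
    cancel : ∀ x y c → (x ℤ.- c) ℤ.- (y ℤ.- c) ≡ x ℤ.- y
    cancel = ℤ-Solver.solve-∀

  periodic-▷ : ∀ {n K} P → Periodic n K → Periodic n (P ▷ K)
  periodic-▷ P K-per x y x≡y = cong sum (map-cong (λ t → periodic-shift t K-per x y x≡y) P)

  ▷-map-≡[] : ∀ {n K} → Periodic n K → ∀ (f g : ℤ → ℤ) → (∀ t → f t ≡[ n ] g t) → ∀ P y →
    (map f P ▷ K) y ≡ (map g P ▷ K) y
  ▷-map-≡[] {K = K} K-per f g f≡g P y = cong sum (trans (sym (map-∘ P)) (trans (map-cong step P) (map-∘ P)))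
    where
    flip : ∀ y a b → (y ℤ.- a) ℤ.- (y ℤ.- b) ≡ b ℤ.- a
    flip = ℤ-Solver.solve-∀
    step : ∀ t → K (y ℤ.- f t) ≡ K (y ℤ.- g t)
    step t = K-per _ _ (≡[]-by-difference (y ℤ.- f t) (y ℤ.- g t) (g t) (f t)
      (flip y (f t) (g t)) (≡[]-sym (f t) (g t) (f≡g t)))

  periodSum : ℕ → (ℤ → ℕ) → ℕ
  periodSum n K = ∑[ i < n ] K (ℤ.+ toℕ i)

  periodSum-shift₁ : ∀ {n K} → Periodic n K → periodSum n (λ x → K (x ℤ.- ℤ.+ 1)) ≡ periodSum n K
  periodSum-shift₁ {zero}   K-per = refl
  periodSum-shift₁ {suc n₀} {K} K-per = begin
    K (ℤ.+ 0 ℤ.- ℤ.+ 1) + ∑[ i < n₀ ] K (ℤ.+ suc (toℕ i) ℤ.- ℤ.+ 1)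
      ≡⟨ cong₂ _+_ (K-per _ _ wrap-around) (sum-cong-≗ {n₀} (λ i → cong K (cancel (ℤ.+ toℕ i)))) ⟩
    K (ℤ.+ n₀) + ∑[ i < n₀ ] K (ℤ.+ toℕ i)
      ≡⟨ +-comm (K (ℤ.+ n₀)) _ ⟩
    ∑[ i < n₀ ] K (ℤ.+ toℕ i) + K (ℤ.+ n₀)
      ≡⟨ cong₂ _+_ (sum-cong-≗ {n₀} (λ i → cong (K ∘ ℤ.+_) (toℕ-inject₁ i)))
                   (cong (K ∘ ℤ.+_) (toℕ-fromℕ n₀)) ⟨
    ∑[ i < n₀ ] K (ℤ.+ toℕ (inject₁ i)) + K (ℤ.+ toℕ (fromℕ n₀))
      ≡⟨ sum-init-last (λ i → K (ℤ.+ toℕ i)) ⟨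
    periodSum (suc n₀) K ∎
    where
    open ≡-Reasoning
    cancel : ∀ x → ℤ.+ 1 ℤ.+ x ℤ.- ℤ.+ 1 ≡ x
    cancel = ℤ-Solver.solve-∀
    wrap-around : (ℤ.+ 0 ℤ.- ℤ.+ 1) ≡[ suc n₀ ] (ℤ.+ n₀)
    wrap-around = ≡[]-multiple (ℤ.+ 0 ℤ.- ℤ.+ 1) (ℤ.+ n₀) (ℤ.- ℤ.+ 1) (minus-one (ℤ.+ n₀))
      where
      minus-one : ∀ x → ℤ.+ 0 ℤ.- ℤ.+ 1 ℤ.- x ≡ ℤ.- ℤ.+ 1 ℤ.* (ℤ.+ 1 ℤ.+ x)
      minus-one = ℤ-Solver.solve-∀

  periodSum-shiftℕ : ∀ {n K} → Periodic n K → ∀ m → periodSum n (λ x → K (x ℤ.- ℤ.+ m)) ≡ periodSum n K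
  periodSum-shiftℕ {n} {K} K-per zero = sum-cong-≗ {n} (λ i → cong K (ℤ.+-identityʳ (ℤ.+ toℕ i)))
  periodSum-shiftℕ {n} {K} K-per (suc m) = begin
    periodSum n (λ x → K (x ℤ.- ℤ.+ suc m))
      ≡⟨ sum-cong-≗ {n} (λ i → cong K (split (ℤ.+ toℕ i) (ℤ.+ m))) ⟩
    periodSum n (λ x → K (x ℤ.- ℤ.+ 1 ℤ.- ℤ.+ m))
      ≡⟨ periodSum-shift₁ (periodic-shift (ℤ.+ m) K-per) ⟩
    periodSum n (λ x → K (x ℤ.- ℤ.+ m))
      ≡⟨ periodSum-shiftℕ K-per m ⟩
    periodSum n K ∎
    where
    open ≡-Reasoning
    split : ∀ x y → x ℤ.- (ℤ.+ 1 ℤ.+ y) ≡ x ℤ.- ℤ.+ 1 ℤ.- y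
    split = ℤ-Solver.solve-∀

  module _ (n : ℕ) .{{_ : NonZero n}} where

    ≡[]-%ℕ : ∀ y → y ≡[ n ] (ℤ.+ (y ℤ.%ℕ n))
    ≡[]-%ℕ y = ≡[]-multiple y (ℤ.+ r) q
      (trans (cong (ℤ._- ℤ.+ r) (ℤ.a≡a%ℕn+[a/ℕn]*n y n)) (cancel (ℤ.+ r) q (ℤ.+ n)))
      where
      r = y ℤ.%ℕ n
      q = y ℤ./ℕ n
      cancel : ∀ r q m → (r ℤ.+ q ℤ.* m) ℤ.- r ≡ q ℤ.* m
      cancel = ℤ-Solver.solve-∀

    residue : ℤ → Fin n
    residue y = fromℕ< (ℤ.n%ℕd<d y n)

    ≡[]-residue : ∀ y → y ≡[ n ] (ℤ.+ toℕ (residue y))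
    ≡[]-residue y = subst (λ r → y ≡[ n ] (ℤ.+ r)) (sym (toℕ-fromℕ< (ℤ.n%ℕd<d y n))) (≡[]-%ℕ y)

    periodic-const : ∀ {F : ℤ → ℕ} {c} → Periodic n F → (∀ (i : Fin n) → F (ℤ.+ toℕ i) ≡ c) →
      ∀ y → F y ≡ c
    periodic-const F-per F≡c y = trans (F-per _ _ (≡[]-residue y)) (F≡c (residue y))

    periodSum-shift : ∀ {K} → Periodic n K → ∀ c → periodSum n (λ x → K (x ℤ.- c)) ≡ periodSum n K
    periodSum-shift {K} K-per c =
      trans (sum-cong-≗ {n} (λ i → K-per _ _ (reduce (ℤ.+ toℕ i)))) (periodSum-shiftℕ K-per r)
      where
      r = c ℤ.%ℕ n
      flip : ∀ x a b → (x ℤ.- a) ℤ.- (x ℤ.- b) ≡ b ℤ.- a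
      flip = ℤ-Solver.solve-∀
      reduce : ∀ x → (x ℤ.- c) ≡[ n ] (x ℤ.- ℤ.+ r)
      reduce x = ≡[]-by-difference (x ℤ.- c) (x ℤ.- ℤ.+ r) (ℤ.+ r) c
        (flip x c (ℤ.+ r)) (≡[]-sym c (ℤ.+ r) (≡[]-%ℕ c))

    periodSum-▷ : ∀ {K} → Periodic n K → ∀ P → periodSum n (P ▷ K) ≡ length P * periodSum n K
    periodSum-▷ K-per []      = ∑.sum-replicate-zero n
    periodSum-▷ {K} K-per (t ∷ P) =
      trans (∑-distrib-+ {n} (λ i → K (ℤ.+ toℕ i ℤ.- t)) (λ i → (P ▷ K) (ℤ.+ toℕ i)))
            (cong₂ _+_ (periodSum-shift K-per t) (periodSum-▷ K-per P))

    -- D ≡ d modulo n m, hence modulo n, and every common divisor of D and m divides d.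
    coprime-representative : ∀ m .{{_ : NonZero m}} d → Coprime ℤ.∣ d ∣ m →
      ∃[ D ] NonZero D × d ≡[ n ] (ℤ.+ D) × Coprime D m
    coprime-representative m d d⊥m = D , >-nonZero (≤-trans (>-nonZero⁻¹ N) (m≤m+n N r)) , d≡D , D⊥m
      where
      instance _ = m*n≢0 n m
      N = n * m
      r = d ℤ.%ℕ N
      q = d ℤ./ℕ N
      D = N + r
      d≡r+qN : d ≡ ℤ.+ r ℤ.+ q ℤ.* ℤ.+ N
      d≡r+qN = ℤ.a≡a%ℕn+[a/ℕn]*n d N
      regroup : ∀ r q n m → (r ℤ.+ q ℤ.* (n ℤ.* m)) ℤ.- (n ℤ.* m ℤ.+ r) ≡ ((q ℤ.- ℤ.+ 1) ℤ.* m) ℤ.* n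
      regroup = ℤ-Solver.solve-∀
      d≡D : d ≡[ n ] (ℤ.+ D)
      d≡D = ≡[]-multiple d (ℤ.+ D) ((q ℤ.- ℤ.+ 1) ℤ.* ℤ.+ m)
        (trans (cong₂ ℤ._-_ d≡r+qN refl)
          (trans (cong (λ x → (ℤ.+ r ℤ.+ q ℤ.* x) ℤ.- (x ℤ.+ ℤ.+ r)) (ℤ.pos-* n m))
                 (regroup (ℤ.+ r) q (ℤ.+ n) (ℤ.+ m))))
      D⊥m : Coprime D m
      D⊥m {c} (c∣D , c∣m) = d⊥m (ℤ∣.∣⇒∣ᵤ (subst (ℤ.+ c ℤ∣.∣_) (sym d≡r+qN)
        (ℤ∣.∣m∣n⇒∣m+n (ℤ∣.∣ᵤ⇒∣ {ℤ.+ c} {ℤ.+ r} c∣r)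
                      (ℤ∣.∣n⇒∣m*n q (ℤ∣.∣ᵤ⇒∣ {ℤ.+ c} {ℤ.+ N} c∣N)))) , c∣m)
        where
        c∣N = ∣n⇒∣m*n n c∣m
        c∣r = ∣m+n∣m⇒∣n c∣D c∣N

  -- Dilating a tiling

  Tiles : List ℤ → (ℤ → ℕ) → Set
  Tiles P K = ∀ y → (P ▷ K) y ≡ 1

  module _ {n : ℕ} .{{_ : NonZero n}} {K : ℤ → ℕ} (K-per : Periodic n K) where

    tiles-*-prime : ∀ {p} P → Prime p → ¬ p ∣ length P → Tiles P K → Tiles (map (ℤ.+ p ℤ.*_) P) K
    tiles-*-prime {zero}  P pr = contradiction refl (≢-nonZero⁻¹ 0 {{prime⇒nonZero pr}})
    tiles-*-prime {suc q} P pr p∤m P-tiles =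
      periodic-const n (periodic-▷ pP K-per)
        (∑≡size⇒≡1 (λ i → (pP ▷ K) (ℤ.+ toℕ i)) (λ i → positive (ℤ.+ toℕ i)) total)
      where
      pP = map (ℤ.+ suc q ℤ.*_) P
      positive : ∀ y → 1 ≤ (pP ▷ K) y
      positive y with frobenius pr P K y
      ... | r , frob = n≢0⇒n>0 λ pP▷K≡0 → p∤m (prime∣^⇒∣ pr q (divides r (begin
        length P ^ q                  ≡⟨ fold-▷-const P P-tiles q y ⟨
        fold K (P ▷_) (suc q) y       ≡⟨ frob ⟩
        (pP ▷ K) y + r * suc q        ≡⟨ cong (_+ r * suc q) pP▷K≡0 ⟩
        r * suc q                     ∎)))
        where open ≡-Reasoning
      total : periodSum n (pP ▷ K) ≡ n
      total = begin
        periodSum n (pP ▷ K)          ≡⟨ periodSum-▷ n K-per pP ⟩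
        length pP * periodSum n K     ≡⟨ cong (_* periodSum n K) (length-map _ P) ⟩
        length P * periodSum n K      ≡⟨ periodSum-▷ n K-per P ⟨
        periodSum n (P ▷ K)           ≡⟨ sum-cong-≗ {n} (λ i → P-tiles (ℤ.+ toℕ i)) ⟩
        ∑[ i < n ] 1                  ≡⟨ ∑-1 n ⟩
        n                             ∎
        where open ≡-Reasoning

    tiles-*-product : ∀ P {ps} → All Prime ps → Coprime (product ps) (length P) → Tiles P K →
      Tiles (map (ℤ.+ product ps ℤ.*_) P) K
    tiles-*-product P []         _   P-tiles =
      subst (λ Q → Tiles Q K) (sym (trans (map-cong ℤ.*-identityˡ P) (map-id P))) P-tiles
    tiles-*-product P {p ∷ ps} (p-prime ∷ ps-prime) p*e⊥m P-tiles =
      subst (λ Q → Tiles Q K) map-*-assoc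
        (tiles-*-prime eP p-prime p∤|eP| (tiles-*-product P ps-prime e⊥m P-tiles))
      where
      e = product ps
      eP = map (ℤ.+ e ℤ.*_) P
      map-*-assoc : map (ℤ.+ p ℤ.*_) eP ≡ map (ℤ.+ (p * e) ℤ.*_) P
      map-*-assoc = trans (sym (map-∘ P))
        (map-cong (λ t → trans (sym (ℤ.*-assoc (ℤ.+ p) (ℤ.+ e) t)) (cong (ℤ._* t) (sym (ℤ.pos-* p e)))) P)
      e⊥m : Coprime e (length P)
      e⊥m (c∣e , c∣m) = p*e⊥m (∣n⇒∣m*n p c∣e , c∣m)
      p∤|eP| : ¬ p ∣ length eP
      p∤|eP| p∣|eP| = nonTrivial⇒≢1 {{prime⇒nonTrivial p-prime}}
        (p*e⊥m (∣m⇒∣m*n e ∣-refl , subst (p ∣_) (length-map _ P) p∣|eP|))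

    tiles-* : ∀ P d → Coprime ℤ.∣ d ∣ (length P) → Tiles P K → Tiles (map (d ℤ.*_) P) K
    tiles-* []          d d⊥m P-tiles = contradiction (P-tiles (ℤ.+ 0)) λ ()
    tiles-* P@(_ ∷ _) d d⊥m P-tiles y with coprime-representative n (length P) d d⊥m
    ... | D , D≢0 , d≡D , D⊥m =
      trans (▷-map-≡[] K-per (d ℤ.*_) (ℤ.+ D ℤ.*_) (λ t → ≡[]-*ʳ d (ℤ.+ D) t d≡D) P y)
            (subst (λ e → Tiles (map (ℤ.+ e ℤ.*_) P) K) (sym isFactorisation)
              (tiles-*-product P factorsPrime (subst (λ e → Coprime e (length P)) isFactorisation D⊥m) P-tiles) y)
      where
      instance _ = D≢0
      fac = factorise D
      open PrimeFactorisation fac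

  deduplicate-unique : ∀ {A : Set} (_≟_ : DecidableEquality A) {L : List A} → Unique L → deduplicate _≟_ L ≡ L
  deduplicate-unique _≟_ {[]}    []               = refl
  deduplicate-unique _≟_ {x ∷ L} (x∉L ∷ L-unique) rewrite deduplicate-unique _≟_ L-unique =
    cong (x ∷_) (filter-all (¬? ∘ (x ≟_)) x∉L)

  unique-map-* : ∀ {P} d → Coprime ℤ.∣ d ∣ (length P) → Unique P → Unique (map (d ℤ.*_) P)
  -- Coprime 0 m forces m ≡ 1, so for d = 0 only singletons remain.
  unique-map-* {P} d@(ℤ.+ zero) d⊥m P-unique with d⊥m (length P ∣0 , ∣-refl)
  unique-map-* {_ ∷ []} d@(ℤ.+ zero) d⊥m P-unique | _ = [] ∷ []
  unique-map-* d@(ℤ.+ suc _) d⊥m = Unique.map⁺ (ℤ.*-cancelˡ-≡ d _ _)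
  unique-map-* d@(ℤ.-[1+ _ ]) d⊥m = Unique.map⁺ (ℤ.*-cancelˡ-≡ d _ _)

module Border (n : ℕ) (X : List (Fin n × Fin n)) where

  open Tiling
  open import Data.Bool using (if_then_else_)
  open import Data.Fin using (toℕ)
  open import Data.Integer as ℤ using (ℤ)
  import Data.Integer.Tactic.RingSolver as ℤ-Solver
  open import Data.List.Properties using (map-cong)
  open import Data.Nat using (_*_; NonZero)
  open import Data.Nat.Divisibility using (_∣?_)
  open import Data.Nat.ListAction using (sum)
  open import Data.Product using (_,_)
  open import Relation.Binary.PropositionalEquality
  open import Relation.Nullary using (Dec; contradiction; yes; no)
  open import Relation.Nullary.Decidable using (⌊_⌋; _×-dec_)

  if-×-dec : ∀ {A B : Set} (a? : Dec A) (b? : Dec B) →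
    (if ⌊ a? ×-dec b? ⌋ then 1 else 0) ≡ (if ⌊ a? ⌋ then 1 else 0) * (if ⌊ b? ⌋ then 1 else 0)
  if-×-dec (yes _) (yes _) = refl
  if-×-dec (yes _) (no _)  = refl
  if-×-dec (no _)  _       = refl

  δ : ℤ → ℤ → ℕ
  δ x y = if ⌊ x ≡[ n ]? y ⌋ then 1 else 0

  δ-+ˡ : ∀ t x y → δ (t ℤ.+ x) y ≡ δ x (y ℤ.- t)
  δ-+ˡ t x y = cong (λ d → if ⌊ n ∣? ℤ.∣ d ∣ ⌋ then 1 else 0) (regroup t x y)
    where
    regroup : ∀ t x y → (t ℤ.+ x) ℤ.- y ≡ x ℤ.- (y ℤ.- t)
    regroup = ℤ-Solver.solve-∀

  δ-+ʳ : ∀ x t y → δ (x ℤ.+ t) y ≡ δ x (y ℤ.- t)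
  δ-+ʳ x t y = cong (λ d → if ⌊ n ∣? ℤ.∣ d ∣ ⌋ then 1 else 0) (regroup x t y)
    where
    regroup : ∀ x t y → (x ℤ.+ t) ℤ.- y ≡ x ℤ.- (y ℤ.- t)
    regroup = ℤ-Solver.solve-∀

  δ-periodic : ∀ x → Periodic n (δ x)
  δ-periodic x y y′ y≡y′ with x ≡[ n ]? y | x ≡[ n ]? y′
  ... | yes _   | yes _    = refl
  ... | no _    | no _     = refl
  ... | yes x≡y | no x≢y′  = contradiction (≡[]-trans x y y′ x≡y y≡y′) x≢y′
  ... | no x≢y  | yes x≡y′ = contradiction (≡[]-trans x y′ y x≡y′ (≡[]-sym y y′ y≡y′)) x≢y

  -- multiplicity y z, coeffXQ Q j y, coeffPX P i z and coeffℤ P Q i j are the coefficients of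
  -- a^y b a^z in X, of a^y b a^j in X a^Q, of a^i b a^z in a^P X and of a^i b a^j in a^P X a^Q,
  -- with all exponents read modulo n.
  isAt : ℤ → ℤ → Fin n × Fin n → ℕ
  isAt y z (u , v) = δ (ℤ.+ toℕ u) y * δ (ℤ.+ toℕ v) z

  multiplicity : ℤ → ℤ → ℕ
  multiplicity y z = sum (map (isAt y z) X)

  coeffXQ : List ℤ → ℤ → ℤ → ℕ
  coeffXQ Q j y = (Q ▷ multiplicity y) j

  coeffPX : List ℤ → ℤ → ℤ → ℕ
  coeffPX P i z = (P ▷ (λ y → multiplicity y z)) i

  coeffℤ : List ℤ → List ℤ → ℤ → ℤ → ℕ
  coeffℤ P Q i j = (P ▷ coeffXQ Q j) i

  coeffℤ-swap : ∀ P Q i j → coeffℤ P Q i j ≡ (Q ▷ coeffPX P i) j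
  coeffℤ-swap P Q i j = sum-map-swap P Q (λ p q → multiplicity (i ℤ.- p) (j ℤ.- q))

  coeffXQ-periodic : ∀ Q j → Periodic n (coeffXQ Q j)
  coeffXQ-periodic Q j y y′ y≡y′ = cong sum (map-cong (λ q → cong sum (map-cong (λ where
    (u , v) → cong (_* δ (ℤ.+ toℕ v) (j ℤ.- q)) (δ-periodic (ℤ.+ toℕ u) y y′ y≡y′)) X)) Q)

  coeffPX-periodic : ∀ P i → Periodic n (coeffPX P i)
  coeffPX-periodic P i z z′ z≡z′ = cong sum (map-cong (λ p → cong sum (map-cong (λ where
    (u , v) → cong (δ (ℤ.+ toℕ u) (i ℤ.- p) *_) (δ-periodic (ℤ.+ toℕ v) z z′ z≡z′)) X)) P)

  coeff≡coeffℤ : ∀ P Q (i j : Fin n) → coeff n P X Q i j ≡ coeffℤ P Q (ℤ.+ toℕ i) (ℤ.+ toℕ j)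
  coeff≡coeffℤ P Q i j = cong sum (map-cong (λ p → trans
    (cong sum (map-cong (λ where (u , v) → cong sum (map-cong (λ q → split p (ℤ.+ toℕ u) (ℤ.+ toℕ v) q) Q)) X))
    (sum-map-swap X Q (λ x q → isAt (i′ ℤ.- p) (j′ ℤ.- q) x))) P)
    where
    i′ = ℤ.+ toℕ i
    j′ = ℤ.+ toℕ j
    split : ∀ p u v q → (if ⌊ ((p ℤ.+ u) ≡[ n ]? i′) ×-dec ((v ℤ.+ q) ≡[ n ]? j′) ⌋ then 1 else 0)
                        ≡ δ u (i′ ℤ.- p) * δ v (j′ ℤ.- q)
    split p u v q = trans (if-×-dec ((p ℤ.+ u) ≡[ n ]? i′) ((v ℤ.+ q) ≡[ n ]? j′))
                          (cong₂ _*_ (δ-+ˡ p u i′) (δ-+ʳ v q j′))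

  IsBorderℤ : List ℤ → List ℤ → Set
  IsBorderℤ P Q = ∀ i j → coeffℤ P Q i j ≡ 1

  coeffℤ-periodicʳ : ∀ P Q i → Periodic n (coeffℤ P Q i)
  coeffℤ-periodicʳ P Q i j j′ j≡j′ = begin
    coeffℤ P Q i j             ≡⟨ coeffℤ-swap P Q i j ⟩
    (Q ▷ coeffPX P i) j        ≡⟨ periodic-▷ Q (coeffPX-periodic P i) j j′ j≡j′ ⟩
    (Q ▷ coeffPX P i) j′       ≡⟨ coeffℤ-swap P Q i j′ ⟨
    coeffℤ P Q i j′            ∎
    where open ≡-Reasoning

  isBorderℤ⇒isBorder : ∀ P Q → IsBorderℤ P Q → IsBorder n X P Q
  isBorderℤ⇒isBorder P Q border i j = trans (coeff≡coeffℤ P Q i j) (border (ℤ.+ toℕ i) (ℤ.+ toℕ j))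

  isBorder⇒isBorderℤ : ∀ P Q .{{_ : NonZero n}} → IsBorder n X P Q → IsBorderℤ P Q
  isBorder⇒isBorderℤ P Q border i j =
    periodic-const n (periodic-▷ P (coeffXQ-periodic Q j))
      (λ i′ → periodic-const n (coeffℤ-periodicʳ P Q (ℤ.+ toℕ i′))
        (λ j′ → trans (sym (coeff≡coeffℤ P Q i′ j′)) (border i′ j′)) j) i

  isBorderℤ-+ : ∀ P Q → IsBorderℤ P Q → ∀ s t → IsBorderℤ (map (ℤ._+ s) P) (map (ℤ._+ t) Q)
  isBorderℤ-+ P Q border s t i j = begin
    (map (ℤ._+ s) P ▷ coeffXQ (map (ℤ._+ t) Q) j) i
      ≡⟨ ▷-cong (map (ℤ._+ s) P) (λ y → ▷-map-+ Q (multiplicity y) t j) i ⟩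
    (map (ℤ._+ s) P ▷ coeffXQ Q (j ℤ.- t)) i
      ≡⟨ ▷-map-+ P (coeffXQ Q (j ℤ.- t)) s i ⟩
    coeffℤ P Q (i ℤ.- s) (j ℤ.- t)
      ≡⟨ border (i ℤ.- s) (j ℤ.- t) ⟩
    1 ∎
    where open ≡-Reasoning

  isBorderℤ-*ˡ : ∀ P Q .{{_ : NonZero n}} → IsBorderℤ P Q → ∀ d → Coprime ℤ.∣ d ∣ (length P) →
    IsBorderℤ (map (d ℤ.*_) P) Q
  isBorderℤ-*ˡ P Q border d d⊥|P| i j = tiles-* (coeffXQ-periodic Q j) P d d⊥|P| (λ i → border i j) i

  isBorderℤ-*ʳ : ∀ P Q .{{_ : NonZero n}} → IsBorderℤ P Q → ∀ d → Coprime ℤ.∣ d ∣ (length Q) →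
    IsBorderℤ P (map (d ℤ.*_) Q)
  isBorderℤ-*ʳ P Q border d d⊥|Q| i j = trans (coeffℤ-swap P (map (d ℤ.*_) Q) i j)
    (tiles-* (coeffPX-periodic P i) Q d d⊥|Q| (λ j → trans (sym (coeffℤ-swap P Q i j)) (border i j)) j)

  isBorder-+ : ∀ P Q .{{_ : NonZero n}} → IsBorder n X P Q →
    ∀ s t → IsBorder n X (map (ℤ._+ s) P) (map (ℤ._+ t) Q)
  isBorder-+ P Q border s t = isBorderℤ⇒isBorder (map (ℤ._+ s) P) (map (ℤ._+ t) Q)
    (isBorderℤ-+ P Q (isBorder⇒isBorderℤ P Q border) s t)

  isBorder-* : ∀ P Q .{{_ : NonZero n}} → IsBorder n X P Q →
    ∀ d₁ d₂ → Coprime ℤ.∣ d₁ ∣ (length P) → Coprime ℤ.∣ d₂ ∣ (length Q) →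
    IsBorder n X (map (d₁ ℤ.*_) P) (map (d₂ ℤ.*_) Q)
  isBorder-* P Q border d₁ d₂ d₁⊥|P| d₂⊥|Q| = isBorderℤ⇒isBorder d₁P (map (d₂ ℤ.*_) Q)
    (isBorderℤ-*ʳ d₁P Q (isBorderℤ-*ˡ P Q (isBorder⇒isBorderℤ P Q border) d₁ d₁⊥|P|) d₂ d₂⊥|Q|)
    where
    d₁P = map (d₁ ℤ.*_) P

open import Data.Integer using (ℤ; _+_; _*_; ∣_∣; _≟_)
open import Data.Nat using (zero; suc)
open import Data.Product using (_,_)
open import Relation.Binary.PropositionalEquality using (sym; subst₂)
open Tiling using (deduplicate-unique; unique-map-*)

mainTheorem12 : {A : Set} (a b : A) → a ≢ b →
    (n : ℕ) (X : List (Fin n × Fin n)) → IsCbc a b n X →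
    (P Q : List ℤ) → Unique P → Unique Q → IsBorder n X P Q →
    ((i j : ℤ) → IsBorder n X (map (_+ i) P) (map (_+ j) Q))
    × ((d₁ d₂ : ℤ) → Coprime ∣ d₁ ∣ (length P) → Coprime ∣ d₂ ∣ (length Q) →
       IsBorder n X (deduplicate _≟_ (map (d₁ *_) P)) (deduplicate _≟_ (map (d₂ *_) Q)))
mainTheorem12 _ _ _ zero     X _ P Q _ _ _ = (λ _ _ ()) , (λ _ _ _ _ ())
mainTheorem12 _ _ _ (suc n₀) X _ P Q P-unique Q-unique border =
    isBorder-+ P Q border
  , λ d₁ d₂ d₁⊥|P| d₂⊥|Q| → subst₂ (IsBorder (suc n₀) X)
      (sym (deduplicate-unique _≟_ (unique-map-* d₁ d₁⊥|P| P-unique)))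
      (sym (deduplicate-unique _≟_ (unique-map-* d₂ d₂⊥|Q| Q-unique)))
      (isBorder-* P Q border d₁ d₂ d₁⊥|P| d₂⊥|Q|)
  where open Border (suc n₀) X
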